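{- Let $n\ge 5$ with $n\equiv 0$ or $5 \pmod 6$, and let $k=\lfloor (n+2)/6\rfloor$. Then the graph $G_{n,k}$ is 3-colorable.
   Context: For positive integers $n,k$, $G_{n,k}$ is the graph with vertex set $\{0,1,\dots,n-1\}$ in which distinct vertices $i,j$ are adjacent if and only if $i-j \bmod n$ lies in $\{\pm k,\pm(k+1),\dots,\pm(2k-1)\} \bmod n$ (a circulant graph). -}

module Defs where

open import Data.Nat using (ℕ; _+_; _≤_; _∸_; _%_; NonZero)
open import Data.Fin using (Fin; toℕ)
open import Data.Product using (∃; _×_)
open import Data.Sum using (_⊎_)
open import Relation.Binary.PropositionalEquality using (_≡_; _≢_)

-- The connection set {±k, ±(k+1), ..., ±(2k-1)} mod n:
-- i ~ j  iff  i ≠ j and there is d with k ≤ d ≤ 2k-1 such that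
-- j - i ≡ d (mod n) or i - j ≡ d (mod n),
-- encoded on residues as (i + d) mod n = j or (j + d) mod n = i.
Adj : (n k : ℕ) → .{{_ : NonZero n}} → Fin n → Fin n → Set
Adj n k i j =
  i ≢ j ×
  ∃ λ d → k ≤ d × d ≤ (k + k) ∸ 1 ×
    ((toℕ i + d) % n ≡ toℕ j ⊎ (toℕ j + d) % n ≡ toℕ i)

ProperColouring : (n k m : ℕ) → .{{_ : NonZero n}} → (Fin n → Fin m) → Set
ProperColouring n k m c = ∀ i j → Adj n k i j → c i ≢ c j

Colourable : (n k m : ℕ) → .{{_ : NonZero n}} → Set
Colourable n k m = ∃ λ (c : Fin n → Fin m) → ProperColouring n k m c

{-# OPTIONS --safe #-}
module Submission where

-- Colour x by ⌊x/k⌋ mod 3, where 6k − 1 ≤ n ≤ 6k. A jump d with k ≤ d ≤ 2k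
-- raises ⌊x/k⌋ by 1 or 2, so it changes the colour. A jump around the cycle
-- lands at x + d − n = x + (d + e) − 6k with e = 6k − n ∈ {0, 1}; subtracting
-- 6k lowers ⌊x/k⌋ by 6, invisible mod 3, so the colours see a jump by
-- d + e ∈ [k, 2k] and again change.

open import Defs
open import Data.Nat using (ℕ; suc; _≤_; _<_; _+_; _*_; _∸_; _/_; _%_; NonZero; >-nonZero; z≤n; s≤s)
open import Data.Nat.Properties
open import Data.Nat.DivMod
open import Data.Nat.Divisibility using (divides-refl)
open import Data.Fin using (Fin; toℕ; fromℕ<)
open import Data.Fin.Properties using (toℕ<n; fromℕ<-injective)
open import Data.Product using (∃; _×_; _,_)
open import Data.Sum using (_⊎_; inj₁; inj₂)
open import Relation.Binary.PropositionalEquality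
open import Relation.Nullary using (yes; no)

residue-shift-≢ : ∀ {r t} → r < 3 → 1 ≤ t → t ≤ 2 → (r + t) % 3 ≢ r
residue-shift-≢ {0} {1} _ _ _ ()
residue-shift-≢ {0} {2} _ _ _ ()
residue-shift-≢ {1} {1} _ _ _ ()
residue-shift-≢ {1} {2} _ _ _ ()
residue-shift-≢ {2} {1} _ _ _ ()
residue-shift-≢ {2} {2} _ _ _ ()
residue-shift-≢ {suc (suc (suc _))} (s≤s (s≤s (s≤s ())))
residue-shift-≢ {_} {suc (suc (suc _))} _ _ (s≤s (s≤s ()))

[m+t]%3≢m%3 : ∀ m {t} → 1 ≤ t → t ≤ 2 → (m + t) % 3 ≢ m % 3
[m+t]%3≢m%3 m {t} 1≤t t≤2 eq = residue-shift-≢ (m%n<n m 3) 1≤t t≤2 (begin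
  (m % 3 + t) % 3     ≡⟨ cong (λ u → (m % 3 + u) % 3) (sym (m<n⇒m%n≡m (s≤s t≤2))) ⟩
  (m % 3 + t % 3) % 3 ≡⟨ sym (%-distribˡ-+ m t 3) ⟩
  (m + t) % 3         ≡⟨ eq ⟩
  m % 3               ∎)
  where open ≡-Reasoning

%3-≢-between : ∀ {x y} → y + 1 ≤ x → x ≤ y + 2 → x % 3 ≢ y % 3
%3-≢-between {x} {y} lo hi =
  subst (λ z → z % 3 ≢ y % 3) (m+[n∸m]≡n y≤x) ([m+t]%3≢m%3 y 1≤x∸y x∸y≤2)
  where
  y≤x : y ≤ x
  y≤x = ≤-trans (m≤m+n y 1) lo
  1≤x∸y : 1 ≤ x ∸ y
  1≤x∸y = subst (_≤ x ∸ y) (m+n∸m≡n y 1) (∸-monoˡ-≤ y lo)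
  x∸y≤2 : x ∸ y ≤ 2
  x∸y≤2 = subst (x ∸ y ≤_) (m+n∸m≡n y 2) (∸-monoˡ-≤ y hi)

[m+p*k]/k≡m/k+p : ∀ m p {k} .{{_ : NonZero k}} → (m + p * k) / k ≡ m / k + p
[m+p*k]/k≡m/k+p m p {k} = trans (+-distrib-/-∣ʳ m (divides-refl p)) (cong (m / k +_) (m*n/n≡m p k))

[m+d]/k-between : ∀ m {d k} .{{_ : NonZero k}} → k ≤ d → d ≤ k + k →
                  m / k + 1 ≤ (m + d) / k × (m + d) / k ≤ m / k + 2
[m+d]/k-between m {d} {k} k≤d d≤2k =
    ≤-trans (≤-reflexive (sym (step 1 (+-identityʳ k)))) (/-monoˡ-≤ k (+-monoʳ-≤ m k≤d))
  , ≤-trans (/-monoˡ-≤ k (+-monoʳ-≤ m d≤2k)) (≤-reflexive (step 2 (cong (k +_) (+-identityʳ k))))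
  where
  step : ∀ p {j} → p * k ≡ j → (m + j) / k ≡ m / k + p
  step p refl = [m+p*k]/k≡m/k+p m p

m<n+n⇒m%n≡m⊎m%n+n≡m : ∀ {m} n .{{_ : NonZero n}} → m < n + n → m % n ≡ m ⊎ m % n + n ≡ m
m<n+n⇒m%n≡m⊎m%n+n≡m {m} n m<2n with m <? n
... | yes m<n = inj₁ (m<n⇒m%n≡m m<n)
... | no m≮n = inj₂ (begin
  m % n + n       ≡⟨ cong (_+ n) (sym (m≤n⇒[n∸m]%m≡n%m n≤m)) ⟩
  (m ∸ n) % n + n ≡⟨ cong (_+ n) (m<n⇒m%n≡m m∸n<n) ⟩
  m ∸ n + n       ≡⟨ m∸n+n≡m n≤m ⟩
  m               ∎)
  where
  open ≡-Reasoning
  n≤m : n ≤ m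
  n≤m = ≮⇒≥ m≮n
  m∸n<n : m ∸ n < n
  m∸n<n = +-cancelʳ-< n (m ∸ n) n (subst (_< n + n) (sym (m∸n+n≡m n≤m)) m<2n)

m≤n+n∸1⇒m<n+n : ∀ {m n} .{{_ : NonZero n}} → m ≤ (n + n) ∸ 1 → m < n + n
m≤n+n∸1⇒m<n+n {n = suc _} = m≤pred[n]⇒suc[m]≤n

module Colouring (n k e : ℕ) .{{_ : NonZero n}} .{{_ : NonZero k}}
                 (e≤1 : e ≤ 1) (n+e≡6k : n + e ≡ 6 * k) where

  colour : ℕ → ℕ
  colour x = (x / k) % 3

  colour-step-≢ : ∀ x {d} → k ≤ d → d ≤ k + k → colour (x + d) ≢ colour x
  colour-step-≢ x k≤d d≤2k with [m+d]/k-between x k≤d d≤2k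
  ... | lo , hi = %3-≢-between lo hi

  colour-+6k : ∀ x → colour (x + 6 * k) ≡ colour x
  colour-+6k x = begin
    ((x + 6 * k) / k) % 3 ≡⟨ cong (_% 3) ([m+p*k]/k≡m/k+p x 6) ⟩
    (x / k + 2 * 3) % 3   ≡⟨ [m+kn]%n≡m%n (x / k) 2 3 ⟩
    (x / k) % 3           ∎
    where open ≡-Reasoning

  jump≤n : ∀ {d} → d < k + k → d ≤ n
  jump≤n {d} d<2k = ≤-pred (begin
    suc d ≤⟨ d<2k ⟩
    k + k ≤⟨ +-monoʳ-≤ k (m≤m+n k (4 * k)) ⟩
    6 * k ≡⟨ sym n+e≡6k ⟩
    n + e ≤⟨ +-monoʳ-≤ n e≤1 ⟩
    n + 1 ≡⟨ +-comm n 1 ⟩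
    suc n ∎)
    where open ≤-Reasoning

  wrapped-jump : ∀ a d {b} → (a + d) % n ≡ b → (a + d) % n + n ≡ a + d → a + (d + e) ≡ b + 6 * k
  wrapped-jump a d {b} a+d≡b wrap = begin
    a + (d + e)         ≡⟨ sym (+-assoc a d e) ⟩
    a + d + e           ≡⟨ cong (_+ e) (sym wrap) ⟩
    (a + d) % n + n + e ≡⟨ cong (λ z → z + n + e) a+d≡b ⟩
    b + n + e           ≡⟨ +-assoc b n e ⟩
    b + (n + e)         ≡⟨ cong (b +_) n+e≡6k ⟩
    b + 6 * k           ∎
    where open ≡-Reasoning

  colour-edge-≢ : ∀ {a b d} → a < n → k ≤ d → d < k + k → (a + d) % n ≡ b → colour a ≢ colour b
  colour-edge-≢ {a} {b} {d} a<n k≤d d<2k a+d≡b same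
    with m<n+n⇒m%n≡m⊎m%n+n≡m n (+-mono-<-≤ a<n (jump≤n d<2k))
  ... | inj₁ no-wrap = colour-step-≢ a k≤d (<⇒≤ d<2k) (begin
    colour (a + d)       ≡⟨ cong colour (trans (sym no-wrap) a+d≡b) ⟩
    colour b             ≡⟨ sym same ⟩
    colour a             ∎)
    where open ≡-Reasoning
  ... | inj₂ wrap = colour-step-≢ a (≤-trans k≤d (m≤m+n d e)) d+e≤2k (begin
    colour (a + (d + e)) ≡⟨ cong colour (wrapped-jump a d a+d≡b wrap) ⟩
    colour (b + 6 * k)   ≡⟨ colour-+6k b ⟩
    colour b             ≡⟨ sym same ⟩
    colour a             ∎)
    where
    open ≡-Reasoning
    d+e≤2k : d + e ≤ k + k
    d+e≤2k = ≤-trans (+-monoʳ-≤ d e≤1) (≤-trans (≤-reflexive (+-comm d 1)) d<2k)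

  colourFin : Fin n → Fin 3
  colourFin i = fromℕ< (m%n<n (toℕ i / k) 3)

  colourFin-proper : ProperColouring n k 3 colourFin
  colourFin-proper i j (_ , d , k≤d , d≤2k∸1 , inj₁ i+d≡j) same =
    colour-edge-≢ (toℕ<n i) k≤d (m≤n+n∸1⇒m<n+n d≤2k∸1) i+d≡j (fromℕ<-injective _ _ _ _ same)
  colourFin-proper i j (_ , d , k≤d , d≤2k∸1 , inj₂ j+d≡i) same =
    colour-edge-≢ (toℕ<n j) k≤d (m≤n+n∸1⇒m<n+n d≤2k∸1) j+d≡i (fromℕ<-injective _ _ _ _ (sym same))

G-3-colourable : ∀ n k e .{{_ : NonZero n}} .{{_ : NonZero k}} → e ≤ 1 → n + e ≡ 6 * k → Colourable n k 3
G-3-colourable n k e e≤1 n+e≡6k = colourFin , colourFin-proper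
  where open Colouring n k e e≤1 n+e≡6k

[r+m*6+2]/6≡[r+2]/6+m : ∀ r m → (r + m * 6 + 2) / 6 ≡ (r + 2) / 6 + m
[r+m*6+2]/6≡[r+2]/6+m r m = begin
  (r + m * 6 + 2) / 6   ≡⟨ cong (_/ 6) (+-assoc r (m * 6) 2) ⟩
  (r + (m * 6 + 2)) / 6 ≡⟨ cong (λ x → (r + x) / 6) (+-comm (m * 6) 2) ⟩
  (r + (2 + m * 6)) / 6 ≡⟨ cong (_/ 6) (sym (+-assoc r 2 (m * 6))) ⟩
  (r + 2 + m * 6) / 6   ≡⟨ [m+p*k]/k≡m/k+p (r + 2) m ⟩
  (r + 2) / 6 + m       ∎
  where open ≡-Reasoning

n%6≡0⊎5⇒n+e≡6k : ∀ n → n % 6 ≡ 0 ⊎ n % 6 ≡ 5 → ∃ λ e → e ≤ 1 × n + e ≡ 6 * ((n + 2) / 6)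
n%6≡0⊎5⇒n+e≡6k n r≡0⊎5 = by-residue (n % 6) r≡0⊎5 (m≡m%n+[m/n]*n n 6)
  where
  open ≡-Reasoning
  m = n / 6
  by-residue : ∀ r → r ≡ 0 ⊎ r ≡ 5 → n ≡ r + m * 6 → ∃ λ e → e ≤ 1 × n + e ≡ 6 * ((n + 2) / 6)
  by-residue _ (inj₁ refl) n≡ = 0 , z≤n , (begin
    n + 0                 ≡⟨ +-identityʳ n ⟩
    n                     ≡⟨ n≡ ⟩
    m * 6                 ≡⟨ *-comm m 6 ⟩
    6 * m                 ≡⟨ cong (6 *_) (sym ([r+m*6+2]/6≡[r+2]/6+m 0 m)) ⟩
    6 * ((m * 6 + 2) / 6) ≡⟨ cong (λ x → 6 * ((x + 2) / 6)) (sym n≡) ⟩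
    6 * ((n + 2) / 6)     ∎)
  by-residue _ (inj₂ refl) n≡ = 1 , s≤s z≤n , (begin
    n + 1                     ≡⟨ cong (_+ 1) n≡ ⟩
    5 + m * 6 + 1             ≡⟨ +-comm (5 + m * 6) 1 ⟩
    suc m * 6                 ≡⟨ *-comm (suc m) 6 ⟩
    6 * suc m                 ≡⟨ cong (6 *_) (sym ([r+m*6+2]/6≡[r+2]/6+m 5 m)) ⟩
    6 * ((5 + m * 6 + 2) / 6) ≡⟨ cong (λ x → 6 * ((x + 2) / 6)) (sym n≡) ⟩
    6 * ((n + 2) / 6)         ∎)

mainTheorem6 : (n : ℕ) → .{{_ : NonZero n}} → 5 ≤ n → (n % 6 ≡ 0 ⊎ n % 6 ≡ 5) →
    Colourable n ((n + 2) / 6) 3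
mainTheorem6 n 5≤n r≡0⊎5 with n%6≡0⊎5⇒n+e≡6k n r≡0⊎5
... | e , e≤1 , n+e≡6k = G-3-colourable n ((n + 2) / 6) e e≤1 n+e≡6k
  where
  instance
    k≢0 : NonZero ((n + 2) / 6)
    k≢0 = >-nonZero (m≥n⇒m/n>0 (+-monoˡ-≤ 2 (≤-trans (n≤1+n 4) 5≤n)))
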